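{- If $H$ is an $\omega$-independent subset of a Boolean algebra, then $H$ is irredundant, i.e. no $a\in H$ lies in the subalgebra generated by $H\smallsetminus\{a\}$.
   Context: $X\subseteq A$ is $\omega$-independent if $0\notin X$ and for all nonempty finite $F,G\subseteq X$: $\sum F\ne1$, and if $0\ne\prod F\le\sum G$ then $F\cap G\ne\emptyset$. -}

module Defs where

open import Level using (Level; _⊔_)
open import Algebra.Lattice.Bundles using (BooleanAlgebra)
open import Data.List using (List; []; _∷_; foldr)
open import Data.List.Relation.Unary.All using (All)
open import Data.List.Relation.Unary.Any using (Any)
open import Data.Product using (Σ; ∃; _×_)
open import Relation.Nullary.Negation using () renaming (¬_ to Not)

module _ {c ℓ : Level} (B : BooleanAlgebra c ℓ) where
  open BooleanAlgebra B

  ⋁ : List Carrier → Carrier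
  ⋁ = foldr _∨_ ⊥

  ⋀ : List Carrier → Carrier
  ⋀ = foldr _∧_ ⊤

  _≤B_ : Carrier → Carrier → Set ℓ
  x ≤B y = (x ∧ y) ≈ x

  NonEmpty : List Carrier → Set c
  NonEmpty [] = Level.Lift c Data.Empty.⊥ where import Data.Empty
  NonEmpty (_ ∷ _) = Level.Lift c Data.Unit.⊤ where import Data.Unit

  -- finite subset of X, represented by a nonempty list of elements of X
  FinSub : {h : Level} → (Carrier → Set h) → List Carrier → Set (c ⊔ h)
  FinSub X F = NonEmpty F × All X F

  Meets : List Carrier → List Carrier → Set (c ⊔ ℓ)
  Meets F G = ∃ λ x → Any (x ≈_) F × Any (x ≈_) G

  ωIndependent : {h : Level} → (Carrier → Set h) → Set (c ⊔ ℓ ⊔ h)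
  ωIndependent X =
    (∀ x → X x → Not (x ≈ ⊥)) ×
    (∀ F G → FinSub X F → FinSub X G →
       Not (⋁ F ≈ ⊤) ×
       (Not (⋀ F ≈ ⊥) → ⋀ F ≤B ⋁ G → Meets F G))

  data Generated {h : Level} (S : Carrier → Set h) : Carrier → Set (c ⊔ ℓ ⊔ h) where
    gen  : ∀ {x} → S x → Generated S x
    top  : Generated S ⊤
    bot  : Generated S ⊥
    join : ∀ {x y} → Generated S x → Generated S y → Generated S (x ∨ y)
    meet : ∀ {x y} → Generated S x → Generated S y → Generated S (x ∧ y)
    compl : ∀ {x} → Generated S x → Generated S (¬ x)
    resp : ∀ {x y} → x ≈ y → Generated S x → Generated S y

  Minus : {h : Level} → (Carrier → Set h) → Carrier → Carrier → Set (ℓ ⊔ h)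
  Minus H a x = H x × Not (x ≈ a)

  Irredundant : {h : Level} → (Carrier → Set h) → Set (c ⊔ ℓ ⊔ h)
  Irredundant H = ∀ a → H a → Not (Generated (Minus H a) a)

-- Say d decides y if d ≤ y or d ≤ ¬ y.  Splitting a cell ⋀F ∧ ¬⋁G of S along
-- the finitely many generators occurring in y shows that every cell meeting z
-- has a subcell that still meets z and decides y; constructively this holds only
-- up to double negation, which suffices because irredundance is a negation.
-- If a were generated by S = H ∖ {a}, taking the cell ⊤ and z = a yields a
-- nonzero cell of S below a, i.e. ⋀F ≤ a ∨ ⋁G.  By ω-independence F is then
-- nonempty and meets a ∷ G; but F avoids a, and an x in both F and G puts the
-- cell below x ∧ ¬ x = ⊥.
module Submission where

open import Defs
open import Level using (Level; _⊔_; lift)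
open import Algebra.Bundles using (CommutativeSemiring)
open import Algebra.Lattice.Bundles using (BooleanAlgebra)
open import Data.List using (List; []; _∷_)
open import Data.List.Relation.Unary.All as All using (All; []; _∷_)
open import Data.List.Relation.Unary.Any using (Any; here; there)
open import Data.Product using (∃₂; _×_; _,_; proj₁; proj₂)
open import Data.Sum using (_⊎_; inj₁; inj₂)
open import Function using (_∘_)
open import Relation.Binary.Lattice using (Lattice)
open import Relation.Nullary.Negation using () renaming (¬_ to Not)
import Algebra.Lattice.Properties.BooleanAlgebra as BooleanAlgebraProperties
import Algebra.Properties.CommutativeSemigroup as CommutativeSemigroupProperties
import Relation.Binary.Lattice.Properties.JoinSemilattice as JoinSemilatticeProperties
import Relation.Binary.Reasoning.Setoid as SetoidReasoning

module _ {c ℓ : Level} (B : BooleanAlgebra c ℓ) where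
  open BooleanAlgebra B
  open BooleanAlgebraProperties B
  open Lattice ∨-∧-orderTheoreticLattice
    using (_≤_; x∧y≤x; x∧y≤y; ∧-greatest; x≤x∨y; y≤x∨y; ∨-least; joinSemilattice)
    renaming (refl to ≤-refl; trans to ≤-trans; ≤-respʳ-≈ to ≤-respʳ; ≤-respˡ-≈ to ≤-respˡ)
  open JoinSemilatticeProperties joinSemilattice using (x≤y⇒x∨y≈y)
  open CommutativeSemigroupProperties
    (CommutativeSemiring.*-commutativeSemigroup ∨-∧-commutativeSemiring)
    using (xy∙z≈xz∙y; xy∙z≈yz∙x; x∙yz≈xz∙y)
  open SetoidReasoning setoid

  ≤⇒≤B : ∀ {x y} → x ≤ y → _≤B_ B x y
  ≤⇒≤B = sym

  x≤⊤ : ∀ {x} → x ≤ ⊤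
  x≤⊤ {x} = sym (∧-identityʳ x)

  x≤⊥⇒x≈⊥ : ∀ {x} → x ≤ ⊥ → x ≈ ⊥
  x≤⊥⇒x≈⊥ {x} x≤⊥ = trans x≤⊥ (∧-zeroʳ x)

  ⊤≤x⇒x≈⊤ : ∀ {x} → ⊤ ≤ x → x ≈ ⊤
  ⊤≤x⇒x≈⊤ {x} ⊤≤x = sym (trans ⊤≤x (∧-identityˡ x))

  x∧y≉⊥⇒x≉⊥ : ∀ {x y} → Not (x ∧ y ≈ ⊥) → Not (x ≈ ⊥)
  x∧y≉⊥⇒x≉⊥ {x} {y} x∧y≉⊥ x≈⊥ = x∧y≉⊥ (x≤⊥⇒x≈⊥ (≤-respʳ x≈⊥ (x∧y≤x x y)))

  ¬-antitone : ∀ {x y} → x ≤ y → ¬ y ≤ ¬ x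
  ¬-antitone {x} {y} x≤y = begin
    ¬ y          ≈⟨ ¬-cong (sym (trans (∨-comm y x) (x≤y⇒x∨y≈y x≤y))) ⟩
    ¬ (y ∨ x)    ≈⟨ deMorgan₂ y x ⟩
    ¬ y ∧ ¬ x    ∎

  x≤y⇒x≤¬y⇒x≈⊥ : ∀ {x y} → x ≤ y → x ≤ ¬ y → x ≈ ⊥
  x≤y⇒x≤¬y⇒x≈⊥ {y = y} x≤y x≤¬y =
    x≤⊥⇒x≈⊥ (≤-respʳ (∧-complementʳ y) (∧-greatest x≤y x≤¬y))

  x≤¬y⇒x∧y≈⊥ : ∀ {x y} → x ≤ ¬ y → x ∧ y ≈ ⊥
  x≤¬y⇒x∧y≈⊥ {x} {y} x≤¬y = x≤y⇒x≤¬y⇒x≈⊥ (x∧y≤y x y) (≤-trans (x∧y≤x x y) x≤¬y)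

  x≈x∧y∨x∧¬y : ∀ x y → x ≈ (x ∧ y) ∨ (x ∧ ¬ y)
  x≈x∧y∨x∧¬y x y = begin
    x                      ≈⟨ sym (∧-identityʳ x) ⟩
    x ∧ ⊤                  ≈⟨ ∧-congˡ (sym (∨-complementʳ y)) ⟩
    x ∧ (y ∨ ¬ y)          ≈⟨ ∧-distribˡ-∨ x y (¬ y) ⟩
    (x ∧ y) ∨ (x ∧ ¬ y)    ∎

  ∧-halves-⊥ : ∀ {x y z} → (x ∧ y) ∧ z ≈ ⊥ → (x ∧ ¬ y) ∧ z ≈ ⊥ → x ∧ z ≈ ⊥
  ∧-halves-⊥ {x} {y} {z} e₁ e₂ = begin
    x ∧ z                                ≈⟨ x≈x∧y∨x∧¬y (x ∧ z) y ⟩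
    ((x ∧ z) ∧ y) ∨ ((x ∧ z) ∧ ¬ y)      ≈⟨ ∨-cong (xy∙z≈xz∙y x z y) (xy∙z≈xz∙y x z (¬ y)) ⟩
    ((x ∧ y) ∧ z) ∨ ((x ∧ ¬ y) ∧ z)      ≈⟨ ∨-cong e₁ e₂ ⟩
    ⊥ ∨ ⊥                                ≈⟨ ∨-identityʳ ⊥ ⟩
    ⊥                                    ∎

  x∧¬y≤z⇒x≤z∨y : ∀ {x y z} → x ∧ ¬ y ≤ z → x ≤ z ∨ y
  x∧¬y≤z⇒x≤z∨y {x} {y} {z} x∧¬y≤z = ≤-respˡ (sym (x≈x∧y∨x∧¬y x y))
    (∨-least (≤-trans (x∧y≤y x y) (y≤x∨y z y)) (≤-trans x∧¬y≤z (x≤x∨y z y)))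

  ⋀-lowerBound : ∀ {x F} → Any (x ≈_) F → ⋀ B F ≤ x
  ⋀-lowerBound {F = f ∷ F} (here x≈f) = ≤-respʳ (sym x≈f) (x∧y≤x f (⋀ B F))
  ⋀-lowerBound {F = f ∷ F} (there x∈F) = ≤-trans (x∧y≤y f (⋀ B F)) (⋀-lowerBound x∈F)

  ⋁-upperBound : ∀ {x G} → Any (x ≈_) G → x ≤ ⋁ B G
  ⋁-upperBound {G = g ∷ G} (here x≈g) = ≤-respˡ (sym x≈g) (x≤x∨y g (⋁ B G))
  ⋁-upperBound {G = g ∷ G} (there x∈G) = ≤-trans (⋁-upperBound x∈G) (y≤x∨y g (⋁ B G))

  Decides : Carrier → Carrier → Set ℓ
  Decides d y = d ≤ y ⊎ d ≤ ¬ y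

  decides-⊤ : ∀ {d} → Decides d ⊤
  decides-⊤ = inj₁ x≤⊤

  decides-⊥ : ∀ {d} → Decides d ⊥
  decides-⊥ = inj₂ (≤-respʳ (sym ¬⊥≈⊤) x≤⊤)

  decides-resp : ∀ {d y y′} → y ≈ y′ → Decides d y → Decides d y′
  decides-resp y≈y′ (inj₁ d≤y) = inj₁ (≤-respʳ y≈y′ d≤y)
  decides-resp y≈y′ (inj₂ d≤¬y) = inj₂ (≤-respʳ (¬-cong y≈y′) d≤¬y)

  decides-antitone : ∀ {d d′ y} → d′ ≤ d → Decides d y → Decides d′ y
  decides-antitone d′≤d (inj₁ d≤y) = inj₁ (≤-trans d′≤d d≤y)
  decides-antitone d′≤d (inj₂ d≤¬y) = inj₂ (≤-trans d′≤d d≤¬y)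

  decides-¬ : ∀ {d y} → Decides d y → Decides d (¬ y)
  decides-¬ (inj₁ d≤y) = inj₂ (≤-respʳ (sym (¬-involutive _)) d≤y)
  decides-¬ (inj₂ d≤¬y) = inj₁ d≤¬y

  decides-∨ : ∀ {d y z} → Decides d y → Decides d z → Decides d (y ∨ z)
  decides-∨ {y = y} {z} (inj₁ d≤y) _ = inj₁ (≤-trans d≤y (x≤x∨y y z))
  decides-∨ {y = y} {z} (inj₂ _) (inj₁ d≤z) = inj₁ (≤-trans d≤z (y≤x∨y y z))
  decides-∨ {y = y} {z} (inj₂ d≤¬y) (inj₂ d≤¬z) =
    inj₂ (≤-respʳ (sym (deMorgan₂ y z)) (∧-greatest d≤¬y d≤¬z))

  decides-∧ : ∀ {d y z} → Decides d y → Decides d z → Decides d (y ∧ z)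
  decides-∧ {y = y} {z} d-y d-z =
    decides-resp (¬-involutive (y ∧ z))
      (decides-¬ (decides-resp (sym (deMorgan₁ y z)) (decides-∨ (decides-¬ d-y) (decides-¬ d-z))))

  record Refinement {p : Level} (P : Carrier → Set p) (q z y : Carrier) : Set (c ⊔ ℓ ⊔ p) where
    field
      piece         : Carrier
      piece∈P       : P piece
      piece≤q       : piece ≤ q
      piece-meets-z : Not (piece ∧ z ≈ ⊥)
      piece-decides : Decides piece y

  open Refinement

  unrefined : ∀ {p} {P : Carrier → Set p} {q z y} →
    P q → Not (q ∧ z ≈ ⊥) → Decides q y → Refinement P q z y
  unrefined q∈P q∧z≉⊥ q-decides = record
    { piece = _ ; piece∈P = q∈P ; piece≤q = ≤-refl
    ; piece-meets-z = q∧z≉⊥ ; piece-decides = q-decides }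

  refine-further : ∀ {p} {P : Carrier → Set p} {q z y₁ y₂ y} →
    (∀ {d} → Decides d y₁ → Decides d y₂ → Decides d y) →
    (r : Refinement P q z y₁) → Refinement P (piece r) z y₂ → Refinement P q z y
  refine-further combine r₁ r₂ = record
    { piece         = piece r₂
    ; piece∈P       = piece∈P r₂
    ; piece≤q       = ≤-trans (piece≤q r₂) (piece≤q r₁)
    ; piece-meets-z = piece-meets-z r₂
    ; piece-decides = combine (decides-antitone (piece≤q r₂) (piece-decides r₁)) (piece-decides r₂)
    }

  retarget : ∀ {p} {P : Carrier → Set p} {q z y y′} →
    (∀ {d} → Decides d y → Decides d y′) → Refinement P q z y → Refinement P q z y′
  retarget f r = record
    { piece = piece r ; piece∈P = piece∈P r ; piece≤q = piece≤q r
    ; piece-meets-z = piece-meets-z r ; piece-decides = f (piece-decides r) }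

  module _ {s p : Level} {S : Carrier → Set s} {P : Carrier → Set p}
           (P-split : ∀ {x q} → S x → P q → P (q ∧ x) × P (q ∧ ¬ x)) where

    refine : ∀ {y q z} → Generated B S y → P q → Not (q ∧ z ≈ ⊥) →
      Not (Not (Refinement P q z y))
    refine-both : ∀ {y₁ y₂ y q z} →
      (∀ {d} → Decides d y₁ → Decides d y₂ → Decides d y) →
      Generated B S y₁ → Generated B S y₂ → P q → Not (q ∧ z ≈ ⊥) →
      Not (Not (Refinement P q z y))

    refine {q = q} {z} (gen {x} x∈S) q∈P q∧z≉⊥ k =
      with-x (λ e₁ → with-¬x (λ e₂ → q∧z≉⊥ (∧-halves-⊥ e₁ e₂)))
      where
      with-x : Not (Not ((q ∧ x) ∧ z ≈ ⊥))
      with-x ≉⊥ = k record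
        { piece = q ∧ x ; piece∈P = proj₁ (P-split x∈S q∈P) ; piece≤q = x∧y≤x q x
        ; piece-meets-z = ≉⊥ ; piece-decides = inj₁ (x∧y≤y q x) }
      with-¬x : Not (Not ((q ∧ ¬ x) ∧ z ≈ ⊥))
      with-¬x ≉⊥ = k record
        { piece = q ∧ ¬ x ; piece∈P = proj₂ (P-split x∈S q∈P) ; piece≤q = x∧y≤x q (¬ x)
        ; piece-meets-z = ≉⊥ ; piece-decides = inj₂ (x∧y≤y q (¬ x)) }
    refine top q∈P q∧z≉⊥ k = k (unrefined q∈P q∧z≉⊥ decides-⊤)
    refine bot q∈P q∧z≉⊥ k = k (unrefined q∈P q∧z≉⊥ decides-⊥)
    refine (join g₁ g₂) = refine-both decides-∨ g₁ g₂
    refine (meet g₁ g₂) = refine-both decides-∧ g₁ g₂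
    refine (compl g) q∈P q∧z≉⊥ k = refine g q∈P q∧z≉⊥ (k ∘ retarget decides-¬)
    refine (resp y≈y′ g) q∈P q∧z≉⊥ k =
      refine g q∈P q∧z≉⊥ (k ∘ retarget (decides-resp y≈y′))

    refine-both combine g₁ g₂ q∈P q∧z≉⊥ k =
      refine g₁ q∈P q∧z≉⊥ λ r₁ →
      refine g₂ (piece∈P r₁) (piece-meets-z r₁) λ r₂ →
      k (refine-further combine r₁ r₂)

  cell : List Carrier → List Carrier → Carrier
  cell F G = ⋀ B F ∧ ¬ ⋁ B G

  IsCell : {s : Level} → (Carrier → Set s) → Carrier → Set (c ⊔ ℓ ⊔ s)
  IsCell S d = ∃₂ λ F G → All S F × All S G × d ≈ cell F G

  cell-[] : ⊤ ≈ cell [] []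
  cell-[] = sym (trans (∧-congˡ ¬⊥≈⊤) (∧-identityʳ ⊤))

  cell-∷ˡ : ∀ x F G → cell F G ∧ x ≈ cell (x ∷ F) G
  cell-∷ˡ x F G = sym (xy∙z≈yz∙x x (⋀ B F) (¬ ⋁ B G))

  cell-∷ʳ : ∀ x F G → cell F G ∧ ¬ x ≈ cell F (x ∷ G)
  cell-∷ʳ x F G = begin
    (⋀ B F ∧ ¬ ⋁ B G) ∧ ¬ x    ≈⟨ sym (x∙yz≈xz∙y (⋀ B F) (¬ x) (¬ ⋁ B G)) ⟩
    ⋀ B F ∧ (¬ x ∧ ¬ ⋁ B G)    ≈⟨ ∧-congˡ (sym (deMorgan₂ x (⋁ B G))) ⟩
    ⋀ B F ∧ ¬ (x ∨ ⋁ B G)      ∎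

  isCell-split : ∀ {s} {S : Carrier → Set s} {x q} →
    S x → IsCell S q → IsCell S (q ∧ x) × IsCell S (q ∧ ¬ x)
  isCell-split {x = x} x∈S (F , G , F⊆S , G⊆S , q≈cell) =
    (x ∷ F , G , x∈S ∷ F⊆S , G⊆S , trans (∧-congʳ q≈cell) (cell-∷ˡ x F G)) ,
    (F , x ∷ G , F⊆S , x∈S ∷ G⊆S , trans (∧-congʳ q≈cell) (cell-∷ʳ x F G))

module _ {c ℓ h : Level} (B : BooleanAlgebra c ℓ) (H : BooleanAlgebra.Carrier B → Set h)
         (H-indep : ωIndependent B H) {a : BooleanAlgebra.Carrier B} (a∈H : H a) where
  open BooleanAlgebra B
  open BooleanAlgebraProperties B
  open Lattice ∨-∧-orderTheoreticLattice
    using (_≤_; x∧y≤x; x∧y≤y)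
    renaming (trans to ≤-trans; ≤-respˡ-≈ to ≤-respˡ)

  private
    S : Carrier → Set (ℓ ⊔ h)
    S = Minus B H a

    ⊆H : ∀ {F} → All S F → All H F
    ⊆H = All.map proj₁

    ∈⊆S⇒≉a : ∀ {x F} → All S F → Any (x ≈_) F → Not (x ≈ a)
    ∈⊆S⇒≉a F⊆S = All.lookupₛ setoid (λ x≈y x≉a y≈a → x≉a (trans x≈y y≈a)) (All.map proj₂ F⊆S)

  nonzero-cell≰ : ∀ F G → All S F → All S G → Not (cell B F G ≈ ⊥) → Not (cell B F G ≤ a)
  nonzero-cell≰ [] G _ G⊆S _ cell≤a =
    proj₁ (proj₂ H-indep (a ∷ G) (a ∷ G) a∷G⊆H a∷G⊆H)
      (⊤≤x⇒x≈⊤ B (x∧¬y≤z⇒x≤z∨y B cell≤a))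
    where
    a∷G⊆H : FinSub B H (a ∷ G)
    a∷G⊆H = lift _ , a∈H ∷ ⊆H G⊆S
  nonzero-cell≰ F@(_ ∷ _) G F⊆S G⊆S cell≉⊥ cell≤a
    with proj₂ (proj₂ H-indep F (a ∷ G) (lift _ , ⊆H F⊆S) (lift _ , a∈H ∷ ⊆H G⊆S))
           (x∧y≉⊥⇒x≉⊥ B cell≉⊥) (≤⇒≤B B (x∧¬y≤z⇒x≤z∨y B cell≤a))
  ... | x , x∈F , here x≈a = ∈⊆S⇒≉a F⊆S x∈F x≈a
  ... | x , x∈F , there x∈G = cell≉⊥ (x≤y⇒x≤¬y⇒x≈⊥ B
        (≤-trans (x∧y≤x _ _) (⋀-lowerBound B x∈F))
        (≤-trans (x∧y≤y _ _) (¬-antitone B (⋁-upperBound B x∈G))))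

  nonzero-isCell≰ : ∀ {d} → IsCell B S d → Not (d ≈ ⊥) → Not (d ≤ a)
  nonzero-isCell≰ (F , G , F⊆S , G⊆S , d≈cell) d≉⊥ d≤a =
    nonzero-cell≰ F G F⊆S G⊆S (d≉⊥ ∘ trans d≈cell) (≤-respˡ d≈cell d≤a)

mainTheorem10 : {c ℓ h : Level} (B : BooleanAlgebra c ℓ)
    (H : BooleanAlgebra.Carrier B → Set h) →
    ωIndependent B H → Irredundant B H
mainTheorem10 B H H-indep a a∈H a∈⟨H∖a⟩ =
  refine B (isCell-split B) a∈⟨H∖a⟩ ⊤∈cells ⊤∧a≉⊥ conclude
  where
  open BooleanAlgebra B
  open BooleanAlgebraProperties B using (∧-identityˡ)
  open Refinement

  ⊤∈cells : IsCell B (Minus B H a) ⊤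
  ⊤∈cells = [] , [] , [] , [] , cell-[] B

  ⊤∧a≉⊥ : Not (⊤ ∧ a ≈ ⊥)
  ⊤∧a≉⊥ e = proj₁ H-indep a a∈H (trans (sym (∧-identityˡ a)) e)

  conclude : Not (Refinement B (IsCell B (Minus B H a)) ⊤ a a)
  conclude r with piece-decides r
  ... | inj₁ piece≤a = nonzero-isCell≰ B H H-indep a∈H (piece∈P r)
                         (x∧y≉⊥⇒x≉⊥ B (piece-meets-z r)) piece≤a
  ... | inj₂ piece≤¬a = piece-meets-z r (x≤¬y⇒x∧y≈⊥ B piece≤¬a)
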